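{- For all integers $n\ge 1$: $p(n,1)=1$ and $p(n,2)=\lfloor n/2\rfloor$. For every integer $k\ge 3$ and $n\ge 1$, $$p(n,k)=\sum_{m_k=1}^{\lfloor n/k\rfloor}\ \sum_{m_{k-1}=0}^{\left\lfloor\frac{n-km_k}{k-1}\right\rfloor}\ \sum_{m_{k-2}=0}^{\left\lfloor\frac{n-(k-1)m_{k-1}-km_k}{k-2}\right\rfloor}\cdots\sum_{m_3=0}^{\left\lfloor\frac{n-\sum_{j=4}^{k}jm_j}{3}\right\rfloor}\left\lfloor\frac{2+n-\sum_{j=3}^{k}jm_j}{2}\right\rfloor,$$ i.e. the outermost index $m_k$ runs from $1$ to $\lfloor n/k\rfloor$ and, for $3\le j\le k-1$, the index $m_j$ runs from $0$ to $\left\lfloor\left(n-\sum_{i=j+1}^{k}im_i\right)/j\right\rfloor$ (for $k=3$ there is just the single sum over $m_3$ from $1$ to $\lfloor n/3\rfloor$). Moreover, for every $n\ge 0$, $$p(n)=1+\left\lfloor\frac n2\right\rfloor+\sum_{k=3}^{n}p(n,k),$$ with $p(n,k)$ for $k\ge3$ given by the nested sum above.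
   Context: A partition of a nonnegative integer $n$ is a multiset of positive integers (parts) summing to $n$. $p(n)$ is the number of partitions of $n$ (with $p(0)=1$) and $p(n,k)$ the number of partitions of $n$ into exactly $k$ parts. -}

module Defs where

open import Data.Nat using (ℕ; zero; suc; _+_; _*_; _∸_; _≤_; _≥_)
open import Data.Nat.DivMod using (_/_)
open import Data.List using (List; map; upTo; length)
open import Data.Nat.ListAction using (sum)
open import Data.List.Relation.Unary.All using (All)
open import Data.List.Relation.Unary.Linked using (Linked)
open import Data.Product using (Σ)
open import Relation.Binary.PropositionalEquality using (_≡_)

-- A partition of n: a multiset of positive integers summing to n,
-- represented canonically as a weakly decreasing list of positive parts.
record Partition (n : ℕ) : Set where
  constructor mkPartition
  field
    parts    : List ℕ
    positive : All (λ x → 1 ≤ x) parts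
    sorted   : Linked _≥_ parts
    sums     : sum parts ≡ n

open Partition public

PartitionInto : ℕ → ℕ → Set
PartitionInto n k = Σ (Partition n) (λ π → length (parts π) ≡ k)

-- Σ_{m=a}^{b} f m  (empty if b < a)
sumFromTo : ℕ → ℕ → (ℕ → ℕ) → ℕ
sumFromTo a b f = sum (map (λ i → f (a + i)) (upTo (suc b ∸ a)))

-- inner t r : the nested sum whose outermost index is m_{t+2}, with
-- remaining amount r = n - Σ_{i > t+2} i m_i.
--   inner 0 r       = ⌊(2 + r)/2⌋                                  (level j = 2)
--   inner (t+1) r   = Σ_{m=0}^{⌊r/(t+3)⌋} inner t (r - (t+3) m)       (level j = t+3)
inner : ℕ → ℕ → ℕ
inner zero r = (2 + r) / 2
inner (suc t) r = sumFromTo 0 (r / (3 + t)) (λ m → inner t (r ∸ (3 + t) * m))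

-- The paper's nested sum for p(n,k), k = 3 + t:
--   Σ_{m_k=1}^{⌊n/k⌋} (inner sums over m_{k-1},...,m_3) ⌊(2 + n - Σ j m_j)/2⌋
nestedSum : ℕ → ℕ → ℕ
nestedSum t n = sumFromTo 1 (n / (3 + t)) (λ m → inner t (n ∸ (3 + t) * m))

{-# OPTIONS --safe #-}
module Submission where

-- List the parts of a partition of n into k parts increasingly, x₁ ≤ … ≤ x_k.
-- Subtracting the smallest part m = x₁ from the others leaves an increasing
-- list of k − 1 numbers ≥ 0 summing to n − k m, with 1 ≤ m ≤ ⌊n/k⌋.  Repeating
-- this on such lists (now with 0 ≤ m) down to two numbers x ≤ y, x + y = r,
-- which leave ⌊r/2⌋ + 1 choices, unfolds exactly into the nested sum:
-- m_j = x_{k−j+1} − x_{k−j} (x₀ = 0).  Sorting the partitions of n by their number of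
-- parts then gives p(n).

open import Defs
open import Data.Nat using (ℕ; _+_; _∸_; _≤_)
open import Data.Nat.DivMod using (_/_)
open import Data.Fin using (Fin)
open import Data.Product using (_×_)
open import Function.Bundles using (_↔_)

open import Data.Fin using (zero; suc; toℕ; fromℕ<)
open import Data.Fin.Properties using (toℕ-injective; toℕ-fromℕ<; toℕ<n; +↔⊎; 1↔⊤)
open import Data.List using (List; []; _∷_; map; length; applyUpTo; reverse; _ʳ++_)
open import Data.List.Properties using (length-map; length-reverse; reverse-involutive)
open import Data.List.Relation.Binary.Permutation.Propositional using (↭-sym)
open import Data.List.Relation.Binary.Permutation.Propositional.Properties
  using (↭-reverse; All-resp-↭)
open import Data.List.Relation.Unary.All as All using (All; []; _∷_)
open import Data.List.Relation.Unary.All.Properties as All using ()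
open import Data.List.Relation.Unary.Linked as Linked using (Linked; []; [-]; _∷_)
open import Data.List.Relation.Unary.Linked.Properties as Linked using (Linked⇒All)
open import Data.Nat using (zero; suc; _*_; _<_; z≤n; s≤s; NonZero)
open import Data.Nat.DivMod using (m*n/n≡m; /-monoˡ-≤; m/n*n≤m; m/n≡1+[m∸n]/n)
open import Data.Nat.ListAction using (sum)
open import Data.Nat.ListAction.Properties using (sum-↭)
open import Data.Nat.Properties
open import Algebra.Properties.CommutativeSemigroup +-commutativeSemigroup using (interchange)
open import Data.Product using (Σ; Σ-syntax; _,_; proj₁)
open import Data.Product.Function.Dependent.Propositional using (Σ-↔)
open import Data.Sum using (_⊎_; inj₁; inj₂)
open import Data.Sum.Function.Propositional using (_⊎-↔_)
open import Data.Unit.Polymorphic using (⊤; tt)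
open import Data.Unit.Polymorphic.Properties using (⊤↔⊤*)
open import Function using (_∘_; flip; id)
open import Function.Bundles using (mk↔ₛ′)
open import Function.Properties.Inverse using (↔-refl; ↔-sym; ↔-trans)
open import Function.Related.Propositional using (module EquationalReasoning)
open import Function.Related.TypeIsomorphisms using (⊎-assoc; ⊎-identityˡ; ×-identityʳ)
open import Level using (0ℓ)
open import Relation.Binary.Core using (Rel)
open import Relation.Nullary using (¬_; contradiction)
open import Relation.Binary.PropositionalEquality
  using (_≡_; refl; sym; trans; cong; cong₂; subst; module ≡-Reasoning)

Between : ℕ → ℕ → Set
Between a b = Σ[ m ∈ ℕ ] a ≤ m × m ≤ b

Between-≡ : ∀ {a b} {m n : Between a b} → proj₁ m ≡ proj₁ n → m ≡ n
Between-≡ {m = m , p , q} {.m , p′ , q′} refl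
  rewrite ≤-irrelevant p p′ | ≤-irrelevant q q′ = refl

Σ-Between-≡ : ∀ {a b} {P : ℕ → Set} {m} {p q : a ≤ m × m ≤ b} {x y : P m} → x ≡ y →
              _≡_ {A = Σ (Between a b) (P ∘ proj₁)} ((m , p) , x) ((m , q) , y)
Σ-Between-≡ {p = p , p′} {q , q′} refl rewrite ≤-irrelevant p q | ≤-irrelevant p′ q′ = refl

i<1+b∸a⇒a+i≤b : ∀ a b {i} → i < suc b ∸ a → a + i ≤ b
i<1+b∸a⇒a+i≤b zero    b           (s≤s i≤b) = i≤b
i<1+b∸a⇒a+i≤b (suc a) zero    {i} i<0∸a     = contradiction (subst (i <_) (0∸n≡0 a) i<0∸a) n≮0
i<1+b∸a⇒a+i≤b (suc a) (suc b)     i<1+b∸a   = s≤s (i<1+b∸a⇒a+i≤b a b i<1+b∸a)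

Fin↔Between : ∀ a b → Fin (suc b ∸ a) ↔ Between a b
Fin↔Between a b = mk↔ₛ′ to from to∘from from∘to
  where
  to : Fin (suc b ∸ a) → Between a b
  to i = a + toℕ i , m≤m+n a (toℕ i) , i<1+b∸a⇒a+i≤b a b (toℕ<n i)

  from : Between a b → Fin (suc b ∸ a)
  from (m , a≤m , m≤b) = fromℕ< (∸-monoˡ-< (s≤s m≤b) a≤m)

  to∘from : ∀ m → to (from m) ≡ m
  to∘from (m , a≤m , m≤b) =
    Between-≡ (trans (cong (a +_) (toℕ-fromℕ< _)) (m+[n∸m]≡n a≤m))

  from∘to : ∀ i → from (to i) ≡ i
  from∘to i = toℕ-injective (trans (toℕ-fromℕ< _) (m+n∸m≡n a (toℕ i)))

Σ-Fin-suc↔⊎ : ∀ {c} {P : Fin (suc c) → Set} → Σ (Fin (suc c)) P ↔ (P zero ⊎ Σ (Fin c) (P ∘ suc))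
Σ-Fin-suc↔⊎ {c} {P} = mk↔ₛ′ to from to∘from from∘to
  where
  to : Σ (Fin (suc c)) P → P zero ⊎ Σ (Fin c) (P ∘ suc)
  to (zero  , p) = inj₁ p
  to (suc i , p) = inj₂ (i , p)

  from : P zero ⊎ Σ (Fin c) (P ∘ suc) → Σ (Fin (suc c)) P
  from (inj₁ p)       = zero , p
  from (inj₂ (i , p)) = suc i , p

  to∘from : ∀ x → to (from x) ≡ x
  to∘from (inj₁ _) = refl
  to∘from (inj₂ _) = refl

  from∘to : ∀ x → from (to x) ≡ x
  from∘to (zero  , _) = refl
  from∘to (suc _ , _) = refl

Fin-sum-map-applyUpTo : ∀ c (g h : ℕ → ℕ) →
                        Fin (sum (map g (applyUpTo h c))) ↔ Σ (Fin c) (λ i → Fin (g (h (toℕ i))))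
Fin-sum-map-applyUpTo zero    g h = mk↔ₛ′ (λ ()) (λ ()) (λ ()) (λ ())
Fin-sum-map-applyUpTo (suc c) g h = begin
  Fin (g (h 0) + sum (map g (applyUpTo (h ∘ suc) c)))
    ↔⟨ +↔⊎ ⟩
  (Fin (g (h 0)) ⊎ Fin (sum (map g (applyUpTo (h ∘ suc) c))))
    ↔⟨ ↔-refl ⊎-↔ Fin-sum-map-applyUpTo c g (h ∘ suc) ⟩
  (Fin (g (h 0)) ⊎ Σ (Fin c) (λ i → Fin (g (h (suc (toℕ i))))))
    ↔⟨ Σ-Fin-suc↔⊎ ⟨
  Σ (Fin (suc c)) (λ i → Fin (g (h (toℕ i)))) ∎
  where open EquationalReasoning

Fin-sumFromTo : ∀ a b (f : ℕ → ℕ) →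
                Fin (sumFromTo a b f) ↔ Σ (Fin (suc b ∸ a)) (λ i → Fin (f (a + toℕ i)))
Fin-sumFromTo a b f = Fin-sum-map-applyUpTo (suc b ∸ a) (λ i → f (a + i)) id

Fin-sumFromTo-Between : ∀ a b (f : ℕ → ℕ) →
                        Fin (sumFromTo a b f) ↔ Σ (Between a b) (Fin ∘ f ∘ proj₁)
Fin-sumFromTo-Between a b f = begin
  Fin (sumFromTo a b f)                           ↔⟨ Fin-sumFromTo a b f ⟩
  Σ (Fin (suc b ∸ a)) (λ i → Fin (f (a + toℕ i))) ↔⟨ Σ-↔ (Fin↔Between a b) ↔-refl ⟩
  Σ (Between a b) (Fin ∘ f ∘ proj₁)               ∎
  where open EquationalReasoning

Fin1↔⊤ : ∀ {ℓ} → Fin 1 ↔ ⊤ {ℓ}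
Fin1↔⊤ = ↔-trans 1↔⊤ (↔-sym ⊤↔⊤*)

record Ascending (lo k r : ℕ) : Set where
  constructor mkAscending
  field
    elems     : List ℕ
    bounded   : All (lo ≤_) elems
    ascending : Linked _≤_ elems
    length≡   : length elems ≡ k
    sum≡      : sum elems ≡ r

open Ascending

Ascending-≡ : ∀ {lo k r} {x y : Ascending lo k r} → elems x ≡ elems y → x ≡ y
Ascending-≡ {x = mkAscending xs b a l s} {mkAscending .xs b′ a′ l′ s′} refl
  rewrite All.irrelevant ≤-irrelevant b b′ | Linked.irrelevant ≤-irrelevant a a′
        | ≡-irrelevant l l′ | ≡-irrelevant s s′ = refl

Linked-∷⁺ : ∀ {A : Set} {R : Rel A 0ℓ} {x ys} → All (R x) ys → Linked R ys → Linked R (x ∷ ys)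
Linked-∷⁺ []      [] = [-]
Linked-∷⁺ (r ∷ _) l  = r ∷ l

Linked-≤⇒All-≥-head : ∀ {x ys} → Linked _≤_ (x ∷ ys) → All (x ≤_) ys
Linked-≤⇒All-≥-head l = All.tail (Linked⇒All ≤-trans ≤-refl l)

map-+-∸ : ∀ {x ys} → All (x ≤_) ys → map (x +_) (map (_∸ x) ys) ≡ ys
map-+-∸ []           = refl
map-+-∸ (x≤y ∷ x≤ys) = cong₂ _∷_ (m+[n∸m]≡n x≤y) (map-+-∸ x≤ys)

map-∸-+ : ∀ m zs → map (_∸ m) (map (m +_) zs) ≡ zs
map-∸-+ m []       = refl
map-∸-+ m (z ∷ zs) = cong₂ _∷_ (m+n∸m≡n m z) (map-∸-+ m zs)

sum-map-+ : ∀ m zs → sum (map (m +_) zs) ≡ length zs * m + sum zs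
sum-map-+ m []       = refl
sum-map-+ m (z ∷ zs) = begin
  (m + z) + sum (map (m +_) zs)      ≡⟨ cong (m + z +_) (sum-map-+ m zs) ⟩
  (m + z) + (length zs * m + sum zs) ≡⟨ interchange m z (length zs * m) (sum zs) ⟩
  (m + length zs * m) + (z + sum zs) ∎
  where open ≡-Reasoning

∷-sum-map-+ : ∀ m zs → m + sum (map (m +_) zs) ≡ suc (length zs) * m + sum zs
∷-sum-map-+ m zs = trans (cong (m +_) (sum-map-+ m zs)) (sym (+-assoc m (length zs * m) (sum zs)))

∷-sum-map-∸ : ∀ {x ys} → All (x ≤_) ys → x + sum ys ≡ suc (length ys) * x + sum (map (_∸ x) ys)
∷-sum-map-∸ {x} {ys} x≤ys = begin
  x + sum ys                    ≡⟨ cong (λ ws → x + sum ws) (map-+-∸ x≤ys) ⟨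
  x + sum (map (x +_) zs)       ≡⟨ ∷-sum-map-+ x zs ⟩
  suc (length zs) * x + sum zs  ≡⟨ cong (λ l → suc l * x + sum zs) (length-map (_∸ x) ys) ⟩
  suc (length ys) * x + sum zs  ∎
  where
  zs : List ℕ
  zs = map (_∸ x) ys

  open ≡-Reasoning

n*m≤o⇒m≤o/n : ∀ {m o} n .{{_ : NonZero n}} → n * m ≤ o → m ≤ o / n
n*m≤o⇒m≤o/n {m} {o} n n*m≤o =
  subst (_≤ o / n) (m*n/n≡m m n) (/-monoˡ-≤ n (subst (_≤ o) (*-comm n m) n*m≤o))

m≤o/n⇒n*m≤o : ∀ {m o} n .{{_ : NonZero n}} → m ≤ o / n → n * m ≤ o
m≤o/n⇒n*m≤o {m} {o} n m≤o/n =
  subst (_≤ o) (*-comm m n) (≤-trans (*-monoˡ-≤ n m≤o/n) (m/n*n≤m o n))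

Ascending-uncons : ∀ a j r →
  Ascending a (suc j) r ↔ Σ (Between a (r / suc j)) (λ m → Ascending 0 j (r ∸ suc j * proj₁ m))
Ascending-uncons a j r = mk↔ₛ′ uncons cons uncons∘cons cons∘uncons
  where
  Rest : Between a (r / suc j) → Set
  Rest m = Ascending 0 j (r ∸ suc j * proj₁ m)

  uncons : Ascending a (suc j) r → Σ (Between a (r / suc j)) Rest
  uncons (mkAscending []       _ _   ()  _)
  uncons (mkAscending (x ∷ ys) b asc len sum≡) =
    (x , All.head b , n*m≤o⇒m≤o/n (suc j) (≤-trans (m≤m+n _ _) (≤-reflexive r≡)))
    , mkAscending zs (All.universal (λ _ → z≤n) zs)
                  (Linked.map⁺ (Linked.map (∸-monoˡ-≤ x) (Linked.tail asc)))
                  (trans (length-map (_∸ x) ys) (suc-injective len))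
                  (trans (sym (m+n∸m≡n (suc j * x) (sum zs))) (cong (_∸ suc j * x) r≡))
    where
    zs : List ℕ
    zs = map (_∸ x) ys

    r≡ : suc j * x + sum zs ≡ r
    r≡ = begin
      suc j * x + sum zs           ≡⟨ cong (λ l → l * x + sum zs) len ⟨
      suc (length ys) * x + sum zs ≡⟨ ∷-sum-map-∸ (Linked-≤⇒All-≥-head asc) ⟨
      x + sum ys                   ≡⟨ sum≡ ⟩
      r                            ∎
      where open ≡-Reasoning

  cons : Σ (Between a (r / suc j)) Rest → Ascending a (suc j) r
  cons ((m , a≤m , m≤r/d) , mkAscending zs _ asc len sum≡) =
    mkAscending (m ∷ map (m +_) zs) (Linked⇒All ≤-trans a≤m asc′) asc′
                (cong suc (trans (length-map (m +_) zs) len)) r≡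
    where
    asc′ : Linked _≤_ (m ∷ map (m +_) zs)
    asc′ = Linked-∷⁺ (All.map⁺ (All.universal (m≤m+n m) zs))
                     (Linked.map⁺ (Linked.map (+-monoʳ-≤ m) asc))

    r≡ : m + sum (map (m +_) zs) ≡ r
    r≡ = begin
      m + sum (map (m +_) zs)         ≡⟨ ∷-sum-map-+ m zs ⟩
      suc (length zs) * m + sum zs    ≡⟨ cong₂ (λ l s → suc l * m + s) len sum≡ ⟩
      suc j * m + (r ∸ suc j * m)     ≡⟨ m+[n∸m]≡n (m≤o/n⇒n*m≤o (suc j) m≤r/d) ⟩
      r                               ∎
      where open ≡-Reasoning

  uncons∘cons : ∀ y → uncons (cons y) ≡ y
  uncons∘cons ((m , _) , mkAscending zs _ _ _ _) = Σ-Between-≡ (Ascending-≡ (map-∸-+ m zs))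

  cons∘uncons : ∀ x → cons (uncons x) ≡ x
  cons∘uncons (mkAscending []       _ _   () _)
  cons∘uncons (mkAscending (x ∷ ys) _ asc _  _) =
    Ascending-≡ (cong (x ∷_) (map-+-∸ (Linked-≤⇒All-≥-head asc)))

Linked-ʳ++⁺ : ∀ {A : Set} {R : Rel A 0ℓ} {x xs ys} →
              Linked R (x ∷ xs) → Linked (flip R) (x ∷ ys) → Linked (flip R) (xs ʳ++ x ∷ ys)
Linked-ʳ++⁺ [-]     acc = acc
Linked-ʳ++⁺ (r ∷ l) acc = Linked-ʳ++⁺ l (r ∷ acc)

Linked-reverse⁺ : ∀ {A : Set} {R : Rel A 0ℓ} {xs} → Linked R xs → Linked (flip R) (reverse xs)
Linked-reverse⁺ {xs = []}    _ = []
Linked-reverse⁺ {xs = _ ∷ _} l = Linked-ʳ++⁺ l [-]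

All-reverse⁺ : ∀ {A : Set} {P : A → Set} {xs} → All P xs → All P (reverse xs)
All-reverse⁺ {xs = xs} = All-resp-↭ (↭-sym (↭-reverse xs))

PartitionInto-≡ : ∀ {n k} {π ρ : PartitionInto n k} → parts (proj₁ π) ≡ parts (proj₁ ρ) → π ≡ ρ
PartitionInto-≡ {π = mkPartition ps p s e , l} {mkPartition .ps p′ s′ e′ , l′} refl
  rewrite All.irrelevant ≤-irrelevant p p′ | Linked.irrelevant ≤-irrelevant s s′
        | ≡-irrelevant e e′ | ≡-irrelevant l l′ = refl

PartitionInto↔Ascending : ∀ n k → PartitionInto n k ↔ Ascending 1 k n
PartitionInto↔Ascending n k = mk↔ₛ′ to from to∘from from∘to
  where
  to : PartitionInto n k → Ascending 1 k n
  to (mkPartition ps pos sorted sums , len) =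
    mkAscending (reverse ps) (All-reverse⁺ pos) (Linked-reverse⁺ sorted)
                (trans (length-reverse ps) len) (trans (sum-↭ (↭-reverse ps)) sums)

  from : Ascending 1 k n → PartitionInto n k
  from (mkAscending xs pos asc len sums) =
    mkPartition (reverse xs) (All-reverse⁺ pos) (Linked-reverse⁺ asc)
                (trans (sum-↭ (↭-reverse xs)) sums)
    , trans (length-reverse xs) len

  to∘from : ∀ x → to (from x) ≡ x
  to∘from x = Ascending-≡ (reverse-involutive (elems x))

  from∘to : ∀ π → from (to π) ≡ π
  from∘to π = PartitionInto-≡ (reverse-involutive (parts (proj₁ π)))

Ascending-singleton↔⊤ : ∀ {ℓ lo r} → lo ≤ r → Ascending lo 1 r ↔ ⊤ {ℓ}
Ascending-singleton↔⊤ {lo = lo} {r} lo≤r =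
  mk↔ₛ′ (λ _ → tt) (λ _ → singleton) (λ _ → refl) from∘to
  where
  singleton : Ascending lo 1 r
  singleton = mkAscending (r ∷ []) (lo≤r ∷ []) [-] refl (+-identityʳ r)

  from∘to : ∀ x → singleton ≡ x
  from∘to (mkAscending []          _ _ () _)
  from∘to (mkAscending (x ∷ [])    _ _ _  sum≡) =
    Ascending-≡ (cong (_∷ []) (trans (sym sum≡) (+-identityʳ x)))
  from∘to (mkAscending (_ ∷ _ ∷ _) _ _ () _)

Ascending-pair↔Between : ∀ lo r → Ascending lo 2 r ↔ Between lo (r / 2)
Ascending-pair↔Between lo r = begin
  Ascending lo 2 r
    ↔⟨ Ascending-uncons lo 1 r ⟩
  Σ (Between lo (r / 2)) (λ m → Ascending 0 1 (r ∸ 2 * proj₁ m))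
    ↔⟨ Σ-↔ ↔-refl (Ascending-singleton↔⊤ z≤n) ⟩
  (Between lo (r / 2) × ⊤)
    ↔⟨ ×-identityʳ 0ℓ _ ⟩
  Between lo (r / 2) ∎
  where open EquationalReasoning

mutual
  inner↔Ascending : ∀ t r → Fin (inner t r) ↔ Ascending 0 (2 + t) r
  inner↔Ascending zero r = begin
    Fin ((2 + r) / 2)  ≡⟨ cong Fin (m/n≡1+[m∸n]/n {2 + r} (s≤s (s≤s z≤n))) ⟩
    Fin (suc (r / 2))  ↔⟨ Fin↔Between 0 (r / 2) ⟩
    Between 0 (r / 2)  ↔⟨ Ascending-pair↔Between 0 r ⟨
    Ascending 0 2 r    ∎
    where open EquationalReasoning
  inner↔Ascending (suc t) r = sumFromTo-inner↔Ascending 0 t r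

  sumFromTo-inner↔Ascending : ∀ a t r →
    Fin (sumFromTo a (r / (3 + t)) (λ m → inner t (r ∸ (3 + t) * m))) ↔ Ascending a (3 + t) r
  sumFromTo-inner↔Ascending a t r = begin
    Fin (sumFromTo a (r / (3 + t)) (λ m → inner t (r ∸ (3 + t) * m)))
      ↔⟨ Fin-sumFromTo-Between a (r / (3 + t)) _ ⟩
    Σ (Between a (r / (3 + t))) (λ m → Fin (inner t (r ∸ (3 + t) * proj₁ m)))
      ↔⟨ Σ-↔ ↔-refl (inner↔Ascending t _) ⟩
    Σ (Between a (r / (3 + t))) (λ m → Ascending 0 (2 + t) (r ∸ (3 + t) * proj₁ m))
      ↔⟨ Ascending-uncons a (2 + t) r ⟨
    Ascending a (3 + t) r ∎
    where open EquationalReasoning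

PartitionInto-1 : ∀ n → 1 ≤ n → Fin 1 ↔ PartitionInto n 1
PartitionInto-1 n 1≤n = begin
  Fin 1               ↔⟨ Fin1↔⊤ ⟩
  ⊤ {0ℓ}              ↔⟨ Ascending-singleton↔⊤ 1≤n ⟨
  Ascending 1 1 n     ↔⟨ PartitionInto↔Ascending n 1 ⟨
  PartitionInto n 1   ∎
  where open EquationalReasoning

PartitionInto-2 : ∀ n → Fin (n / 2) ↔ PartitionInto n 2
PartitionInto-2 n = begin
  Fin (n / 2)         ↔⟨ Fin↔Between 1 (n / 2) ⟩
  Between 1 (n / 2)   ↔⟨ Ascending-pair↔Between 1 n ⟨
  Ascending 1 2 n     ↔⟨ PartitionInto↔Ascending n 2 ⟨
  PartitionInto n 2   ∎
  where open EquationalReasoning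

PartitionInto-3+ : ∀ t n → Fin (nestedSum t n) ↔ PartitionInto n (3 + t)
PartitionInto-3+ t n = begin
  Fin (nestedSum t n)       ↔⟨ sumFromTo-inner↔Ascending 1 t n ⟩
  Ascending 1 (3 + t) n     ↔⟨ PartitionInto↔Ascending n (3 + t) ⟨
  PartitionInto n (3 + t)   ∎
  where open EquationalReasoning

length≤sum : ∀ {xs} → All (1 ≤_) xs → length xs ≤ sum xs
length≤sum []         = z≤n
length≤sum (1≤x ∷ ps) = +-mono-≤ 1≤x (length≤sum ps)

toℕ-fiber-≡ : ∀ {N l} {k k′ : Fin N} (e : l ≡ toℕ k) (e′ : l ≡ toℕ k′) →
              _≡_ {A = Σ (Fin N) (λ k → l ≡ toℕ k)} (k , e) (k′ , e′)
toℕ-fiber-≡ {k = k} e e′ with toℕ-injective (trans (sym e) e′)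
... | refl = cong (k ,_) (≡-irrelevant e e′)

Partition↔Σ-PartitionInto : ∀ {n N} → n < N →
                            Partition n ↔ Σ (Fin N) (λ k → PartitionInto n (toℕ k))
Partition↔Σ-PartitionInto {n} {N} n<N = mk↔ₛ′ to from to∘from (λ _ → refl)
  where
  length<N : (π : Partition n) → length (parts π) < N
  length<N π = ≤-<-trans (subst (length (parts π) ≤_) (sums π) (length≤sum (positive π))) n<N

  to : Partition n → Σ (Fin N) (λ k → PartitionInto n (toℕ k))
  to π = fromℕ< (length<N π) , π , sym (toℕ-fromℕ< (length<N π))

  from : Σ (Fin N) (λ k → PartitionInto n (toℕ k)) → Partition n
  from (_ , π , _) = π

  to∘from : ∀ x → to (from x) ≡ x
  to∘from (k , π , e) =
    cong (λ (k , e) → k , π , e) (toℕ-fiber-≡ (sym (toℕ-fromℕ< (length<N π))) e)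

¬⇒⊎-identityˡ : ∀ {A B : Set} → ¬ A → (A ⊎ B) ↔ B
¬⇒⊎-identityˡ {A} {B} ¬a = mk↔ₛ′ to inj₂ (λ _ → refl) from∘to
  where
  to : A ⊎ B → B
  to (inj₁ a) = contradiction a ¬a
  to (inj₂ b) = b

  from∘to : ∀ x → inj₂ (to x) ≡ x
  from∘to (inj₁ a) = contradiction a ¬a
  from∘to (inj₂ _) = refl

¬PartitionInto-suc-0 : ∀ n → ¬ PartitionInto (suc n) 0
¬PartitionInto-suc-0 n (mkPartition []      _ _ () , _)
¬PartitionInto-suc-0 n (mkPartition (_ ∷ _) _ _ _  , ())

Partition-0↔⊤ : ∀ {ℓ} → Partition 0 ↔ ⊤ {ℓ}
Partition-0↔⊤ = mk↔ₛ′ (λ _ → tt) (λ _ → empty) (λ _ → refl) from∘to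
  where
  empty : Partition 0
  empty = mkPartition [] [] [] refl

  from∘to : ∀ π → empty ≡ π
  from∘to (mkPartition []      [] [] refl) = refl
  from∘to (mkPartition (_ ∷ _) (s≤s _ ∷ _) _ ())

Partition-formula : ∀ n → Fin (1 + n / 2 + sumFromTo 3 n (λ k → nestedSum (k ∸ 3) n)) ↔ Partition n
Partition-formula zero = ↔-trans Fin1↔⊤ (↔-sym (Partition-0↔⊤ {0ℓ}))
Partition-formula n@(suc n′) = begin
  Fin (1 + n / 2 + sumFromTo 3 n (λ k → nestedSum (k ∸ 3) n))
    ↔⟨ +↔⊎ ⟩
  (Fin (1 + n / 2) ⊎ Fin (sumFromTo 3 n (λ k → nestedSum (k ∸ 3) n)))
    ↔⟨ +↔⊎ ⊎-↔ Fin-sumFromTo 3 n (λ k → nestedSum (k ∸ 3) n) ⟩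
  ((Fin 1 ⊎ Fin (n / 2)) ⊎ Σ (Fin c) (λ i → Fin (nestedSum (toℕ i) n)))
    ↔⟨ (PartitionInto-1 n (s≤s z≤n) ⊎-↔ PartitionInto-2 n) ⊎-↔ Σ-↔ ↔-refl (PartitionInto-3+ _ n) ⟩
  ((P 1 ⊎ P 2) ⊎ Σ (Fin c) (λ i → P (3 + toℕ i)))
    ↔⟨ ⊎-assoc 0ℓ _ _ _ ⟩
  (P 1 ⊎ P 2 ⊎ Σ (Fin c) (λ i → P (3 + toℕ i)))
    ↔⟨ ¬⇒⊎-identityˡ (¬PartitionInto-suc-0 n′) ⟨
  (P 0 ⊎ P 1 ⊎ P 2 ⊎ Σ (Fin c) (λ i → P (3 + toℕ i)))
    ↔⟨ ↔-refl ⊎-↔ ↔-refl ⊎-↔ Σ-Fin-suc↔⊎ ⟨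
  (P 0 ⊎ P 1 ⊎ Σ (Fin (1 + c)) (λ i → P (2 + toℕ i)))
    ↔⟨ ↔-refl ⊎-↔ Σ-Fin-suc↔⊎ ⟨
  (P 0 ⊎ Σ (Fin (2 + c)) (λ i → P (1 + toℕ i)))
    ↔⟨ Σ-Fin-suc↔⊎ ⟨
  Σ (Fin (3 + c)) (P ∘ toℕ)
    -- any bound above n works; 3 + c lets Σ-Fin-suc↔⊎ expose the lengths 0, 1, 2
    ↔⟨ Partition↔Σ-PartitionInto (s≤s (m≤n+m∸n n 2)) ⟨
  Partition n ∎
  where
  c : ℕ
  c = suc n ∸ 3

  P : ℕ → Set
  P = PartitionInto n

  open EquationalReasoning

theorem3 : ((n : ℕ) → 1 ≤ n → Fin 1 ↔ PartitionInto n 1)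
    × ((n : ℕ) → 1 ≤ n → Fin (n / 2) ↔ PartitionInto n 2)
    × ((k n : ℕ) → 3 ≤ k → 1 ≤ n → Fin (nestedSum (k ∸ 3) n) ↔ PartitionInto n k)
    × ((n : ℕ) → Fin (1 + n / 2 + sumFromTo 3 n (λ k → nestedSum (k ∸ 3) n)) ↔ Partition n)
theorem3 = PartitionInto-1 , (λ n _ → PartitionInto-2 n) , PartitionInto-≥3 , Partition-formula
  where
  PartitionInto-≥3 : ∀ k n → 3 ≤ k → 1 ≤ n → Fin (nestedSum (k ∸ 3) n) ↔ PartitionInto n k
  PartitionInto-≥3 .(3 + t) n (s≤s (s≤s (s≤s {n = t} _))) _ = PartitionInto-3+ t n
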